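{- The group $P$ acts regularly on the set of points of $\mathsf{W}(3,q)$ not collinear with $\mathbf{x}$. Moreover, $P$ fixes the line $\langle (1,0,0,0),(0,1,0,0)\rangle$ but transitively permutes the remaining $q$ lines through $\mathbf{x}$.
   Context: Let $q=p^f$ with $p$ prime, and let $\mathsf{W}(3,q)$ be the symplectic generalised quadrangle of totally isotropic 1- and 2-subspaces of $\mathrm{GF}(q)^4$ with respect to $\beta(x,y)=x_1y_4-y_1x_4+x_2y_3-y_2x_3$; let $\mathbf{x}:=\langle(1,0,0,0)\rangle$. For $a,b,c\in\mathrm{GF}(q)$ let $t_{a,b,c}$ be the $4\times 4$ matrix with rows $(1,0,0,0)$, $(-c,1,0,0)$, $(b,0,1,0)$, $(a,b,c,1)$, and $R:=\{t_{a,b,0}\mid a,b\in\mathrm{GF}(q)\}$. For $\alpha\in\mathrm{GF}(q)$ let $\theta_{\alpha}$ be the matrix with rows $(1,0,0,0)$, $(-\alpha,1,0,0)$, $(-\alpha^2,\alpha,1,0)$, $(0,0,\alpha,1)$. Let $\{\alpha_1,\ldots,\alpha_f\}$ be a basis of $\mathrm{GF}(q)$ over $\mathrm{GF}(p)$ and $P:=\langle R,\theta_{\alpha_1},\ldots,\theta_{\alpha_f}\rangle$, acting on row vectors by right multiplication. -}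

module Defs where

open import Level using (Level; _⊔_)
open import Algebra.Bundles using (CommutativeRing)
open import Data.Nat as ℕ using (ℕ; zero; suc)
open import Data.Nat.Primality using (Prime)
open import Data.Fin using (Fin; zero; suc; toℕ)
open import Data.Product using (Σ; ∃; ∃-syntax; _×_; _,_)
open import Relation.Nullary using (¬_)
open import Relation.Binary.PropositionalEquality using (_≡_)

-- ===================================================================
-- Everything is relative to a commutative ring F (with setoid equality
-- _≈_); the theorem additionally assumes that F is a field which is a
-- GF(p)-vector space with basis α₁..α_f, i.e. F = GF(p^f).
-- ===================================================================
module Over {c ℓ : Level} (F : CommutativeRing c ℓ) where
  open CommutativeRing F using (Carrier; _≈_; _+_; _*_; -_; 0#; 1#)

  IsField : Set (c ⊔ ℓ)
  IsField = (¬ (0# ≈ 1#)) × (∀ a → ¬ (a ≈ 0#) → ∃[ b ] (a * b ≈ 1#))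

  natMul : ℕ → Carrier → Carrier
  natMul zero    a = 0#
  natMul (suc n) a = a + natMul n a

  HasChar : ℕ → Set ℓ
  HasChar p = natMul p 1# ≈ 0#

  sumFin : (n : ℕ) → (Fin n → Carrier) → Carrier
  sumFin zero    g = 0#
  sumFin (suc n) g = g zero + sumFin n (λ i → g (suc i))

  coord : (p f : ℕ) → (Fin f → Carrier) → (Fin f → Fin p) → Carrier
  coord p f α cs = sumFin f (λ i → natMul (toℕ (cs i)) (α i))

  IsBasisOverPrime : (p f : ℕ) → (Fin f → Carrier) → Set (c ⊔ ℓ)
  IsBasisOverPrime p f α =
    (∀ a → ∃[ cs ] (coord p f α cs ≈ a)) ×
    (∀ cs ds → coord p f α cs ≈ coord p f α ds → ∀ i → cs i ≡ ds i)

  V : Set c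
  V = Fin 4 → Carrier

  Mat : Set c
  Mat = Fin 4 → Fin 4 → Carrier

  vec4 : Carrier → Carrier → Carrier → Carrier → V
  vec4 a b c' d zero                      = a
  vec4 a b c' d (suc zero)                = b
  vec4 a b c' d (suc (suc zero))          = c'
  vec4 a b c' d (suc (suc (suc zero)))    = d

  rowsAt : V → V → V → V → Mat
  rowsAt r₁ r₂ r₃ r₄ zero                   = r₁
  rowsAt r₁ r₂ r₃ r₄ (suc zero)             = r₂
  rowsAt r₁ r₂ r₃ r₄ (suc (suc zero))       = r₃
  rowsAt r₁ r₂ r₃ r₄ (suc (suc (suc zero))) = r₄

  sum4 : (Fin 4 → Carrier) → Carrier
  sum4 = sumFin 4

  _·ᵥ_ : V → Mat → V
  (v ·ᵥ M) j = sum4 (λ i → v i * M i j)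

  _·ₘ_ : Mat → Mat → Mat
  (A ·ₘ B) i j = sum4 (λ k → A i k * B k j)

  _+ᵥ_ : V → V → V
  (u +ᵥ w) i = u i + w i

  _∙ᵥ_ : Carrier → V → V
  (a ∙ᵥ u) i = a * u i

  0ᵥ : V
  0ᵥ i = 0#

  _≈ᵥ_ : V → V → Set ℓ
  u ≈ᵥ w = ∀ i → u i ≈ w i

  _≈ₘ_ : Mat → Mat → Set ℓ
  A ≈ₘ B = ∀ i j → A i j ≈ B i j

  Iₘ : Mat
  Iₘ = rowsAt (vec4 1# 0# 0# 0#) (vec4 0# 1# 0# 0#)
              (vec4 0# 0# 1# 0#) (vec4 0# 0# 0# 1#)

  t : Carrier → Carrier → Carrier → Mat
  t a b c' = rowsAt (vec4 1# 0# 0# 0#)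
                    (vec4 (- c') 1# 0# 0#)
                    (vec4 b 0# 1# 0#)
                    (vec4 a b c' 1#)

  θ : Carrier → Mat
  θ α = rowsAt (vec4 1# 0# 0# 0#)
               (vec4 (- α) 1# 0# 0#)
               (vec4 (- (α * α)) α 1# 0#)
               (vec4 0# 0# α 1#)

  -- P = ⟨ R , θ_{α₁}, …, θ_{α_f} ⟩ with R = { t_{a,b,0} }:
  -- the subgroup of GL(4,F) generated (smallest set containing the
  -- generators and closed under identity, products and inverses;
  -- matrices are compared entrywise up to ≈).
  data InP {f : ℕ} (α : Fin f → Carrier) : Mat → Set (c ⊔ ℓ) where
    genR   : ∀ a b → InP α (t a b 0#)
    genθ   : ∀ i → InP α (θ (α i))
    one    : InP α Iₘ
    mul    : ∀ {A B} → InP α A → InP α B → InP α (A ·ₘ B)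
    inv    : ∀ {A B} → InP α A → (A ·ₘ B) ≈ₘ Iₘ → (B ·ₘ A) ≈ₘ Iₘ → InP α B
    resp   : ∀ {A B} → InP α A → A ≈ₘ B → InP α B

  _−_ : Carrier → Carrier → Carrier
  a − b = a + (- b)

  i₁ i₂ i₃ i₄ : Fin 4
  i₁ = zero
  i₂ = suc zero
  i₃ = suc (suc zero)
  i₄ = suc (suc (suc zero))

  β : V → V → Carrier
  β x y = ((x i₁ * y i₄) − (y i₁ * x i₄)) + ((x i₂ * y i₃) − (y i₂ * x i₃))

  NonZero : V → Set ℓ
  NonZero v = ¬ (v ≈ᵥ 0ᵥ)

  -- a point of W(3,q): a totally isotropic 1-subspace ⟨v⟩, v ≠ 0
  IsPoint : V → Set ℓ
  IsPoint v = NonZero v × (β v v ≈ 0#)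

  SamePoint : V → V → Set (c ⊔ ℓ)
  SamePoint u w = ∃[ a ] (w ≈ᵥ (a ∙ᵥ u))

  -- a line is given by a pair of spanning vectors
  record Line : Set c where
    constructor ⟨_,_⟩
    field
      u w : V
  open Line public

  LinIndep : V → V → Set (c ⊔ ℓ)
  LinIndep u w = ∀ a b → ((a ∙ᵥ u) +ᵥ (b ∙ᵥ w)) ≈ᵥ 0ᵥ → (a ≈ 0#) × (b ≈ 0#)

  IsLine : Line → Set (c ⊔ ℓ)
  IsLine L = LinIndep (u L) (w L) ×
    (∀ a b a' b' → β ((a ∙ᵥ u L) +ᵥ (b ∙ᵥ w L)) ((a' ∙ᵥ u L) +ᵥ (b' ∙ᵥ w L)) ≈ 0#)

  OnLine : V → Line → Set (c ⊔ ℓ)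
  OnLine v L = ∃[ a ] ∃[ b ] (v ≈ᵥ ((a ∙ᵥ u L) +ᵥ (b ∙ᵥ w L)))

  SameLine : Line → Line → Set (c ⊔ ℓ)
  SameLine L L' = ∀ v → (OnLine v L → OnLine v L') × (OnLine v L' → OnLine v L)

  Collinear : V → V → Set (c ⊔ ℓ)
  Collinear y z = ∃[ L ] (IsLine L × OnLine y L × OnLine z L)

  -- images under a matrix (acting on row vectors by right multiplication)
  _^ₗ_ : Line → Mat → Line
  L ^ₗ g = ⟨ u L ·ᵥ g , w L ·ᵥ g ⟩

  𝐱 : V
  𝐱 = vec4 1# 0# 0# 0#

  L₀ : Line
  L₀ = ⟨ vec4 1# 0# 0# 0# , vec4 0# 1# 0# 0# ⟩

  OtherLineThroughX : Line → Set (c ⊔ ℓ)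
  OtherLineThroughX L = IsLine L × OnLine 𝐱 L × ¬ SameLine L L₀

  FarPoint : V → Set (c ⊔ ℓ)
  FarPoint y = IsPoint y × ¬ Collinear 𝐱 y

  Lemma3p12Conclusion : (p f : ℕ) → (Fin f → Carrier) → Set (c ⊔ ℓ)
  Lemma3p12Conclusion p f α =
    (∀ g y → InP α g → FarPoint y → FarPoint (y ·ᵥ g)) ×
    (∀ y z → FarPoint y → FarPoint z → ∃[ g ] (InP α g × SamePoint (y ·ᵥ g) z)) ×
    -- ... and with trivial point stabilisers (so regularly)
    (∀ g y → InP α g → FarPoint y → SamePoint (y ·ᵥ g) y → g ≈ₘ Iₘ) ×
    (∀ g → InP α g → SameLine (L₀ ^ₗ g) L₀) ×
    -- there are exactly q = p^f remaining lines through x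
    (Σ (Fin (p ℕ.^ f) → Line) λ ℓs → ((∀ i → OtherLineThroughX (ℓs i)) ×
              (∀ i j → SameLine (ℓs i) (ℓs j) → i ≡ j) ×
              (∀ L → OtherLineThroughX L → ∃[ i ] SameLine L (ℓs i)))) ×
    (∀ g L → InP α g → OtherLineThroughX L → OtherLineThroughX (L ^ₗ g)) ×
    (∀ L L' → OtherLineThroughX L → OtherLineThroughX L' →
       ∃[ g ] (InP α g × SameLine (L ^ₗ g) L'))

module Submission where

-- Put M a b k = t_{a,b,0} θ_k.  These matrices are closed under
-- products and inverses, so every element of P is some M a b k
-- (normalForm); conversely, as the αᵢ span F over GF(p), P contains them
-- all (M-in-P).  M a b k acts on row vectors by an explicit triangular
-- formula (act), preserves β and fixes x.  Points: y is not collinear with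
-- x iff y₄ ≠ 0 (farPoint⇒, ⇒farPoint), and for such y the equation
-- y M a b k ∼ z has exactly one solution (image-onto, fixesFarPoint).
-- Lines: the lines on x other than L₀ are the lines otherLine s =
-- ⟨x, (0,s,1,0)⟩ (classify), pairwise distinct, and M a b k maps
-- otherLine s to otherLine (s + k) (otherLine-shift).

open import Defs
open import Level using (Level; _⊔_)
open import Algebra.Bundles using (CommutativeRing)
open import Algebra.Bundles.Raw using (RawRing)
open import Data.Nat as ℕ using (ℕ; zero; suc)
import Data.Nat.Properties as ℕP
open import Data.Nat.Primality using (Prime)
open import Data.Integer as ℤ using (ℤ; +_; -[1+_])
import Data.Integer.Properties as ℤP
open import Data.Fin using (Fin; zero; suc)
import Data.Fin
import Data.Fin.Properties as FinP
open import Data.Vec using (Vec; _∷_; [])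
open import Data.Maybe using (Maybe; just; nothing)
open import Data.Product using (Σ; ∃; ∃-syntax; _×_; _,_; proj₁; proj₂)
open import Relation.Nullary using (¬_; yes; no)
open import Relation.Binary.Definitions using (Decidable)
open import Data.Sum using (_⊎_; inj₁; inj₂; [_,_])
open import Data.Empty using (⊥; ⊥-elim)
open import Relation.Binary.PropositionalEquality as ≡ using (_≡_)
import Relation.Binary.Reasoning.Setoid

-- Statements about the four coordinates of F⁴, as a product of four
-- concrete instances (so that each instance can be checked by computation).
Every4 : ∀ {p} → (Fin 4 → Set p) → Set p
Every4 P = P zero × P (suc zero) × P (suc (suc zero)) × P (suc (suc (suc zero)))

every4 : ∀ {p} {P : Fin 4 → Set p} → Every4 P → ∀ i → P i
every4 (p₁ , p₂ , p₃ , p₄) zero                   = p₁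
every4 (p₁ , p₂ , p₃ , p₄) (suc zero)             = p₂
every4 (p₁ , p₂ , p₃ , p₄) (suc (suc zero))       = p₃
every4 (p₁ , p₂ , p₃ , p₄) (suc (suc (suc zero))) = p₄

map4 : ∀ {p q} {P : Fin 4 → Set p} {Q : Fin 4 → Set q} →
       (∀ {i} → P i → Q i) → Every4 P → Every4 Q
map4 g (p₁ , p₂ , p₃ , p₄) = g p₁ , g p₂ , g p₃ , g p₄

pattern refl⁴ = ≡.refl , ≡.refl , ≡.refl , ≡.refl
pattern refl⁴ˣ⁴ = refl⁴ , refl⁴ , refl⁴ , refl⁴

-- A ring solver for any commutative ring R with integer coefficients: the
-- standard library's Algebra.Solver.Ring instantiated with the canonical
-- homomorphism ℤ → R (integer coefficients make normal forms canonical,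
-- so that x + - x and 0 normalise to the same polynomial).
module IntegerSolver {c ℓ : Level} (R : CommutativeRing c ℓ) where
  open CommutativeRing R hiding (zero)
  open import Algebra.Properties.Monoid.Mult.TCOptimised +-monoid using (1+×; ×-homo-+) renaming (_×_ to _⨯_)
  open import Algebra.Properties.Semiring.Mult.TCOptimised semiring using (×1-homo-*)
  open import Algebra.Properties.Ring ring using (-‿involutive; -0#≈0#; -‿distribʳ-*; -‿distribˡ-*; -‿+-comm)
  open import Algebra.Solver.Ring.AlmostCommutativeRing
  open import Relation.Binary.Reasoning.Setoid setoid

  ⟦_⟧ℤ : ℤ → Carrier
  ⟦ + n ⟧ℤ = n ⨯ 1#
  ⟦ -[1+ n ] ⟧ℤ = - (suc n ⨯ 1#)

  -‿homo : ∀ i → ⟦ ℤ.- i ⟧ℤ ≈ - ⟦ i ⟧ℤ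
  -‿homo -[1+ n ] = sym (-‿involutive _)
  -‿homo (+ zero) = sym -0#≈0#
  -‿homo (+ suc n) = refl

  ⊖-homo : ∀ m n → ⟦ m ℤ.⊖ n ⟧ℤ ≈ ⟦ + m ⟧ℤ + - ⟦ + n ⟧ℤ
  ⊖-homo m zero = sym (trans (+-congˡ -0#≈0#) (+-identityʳ _))
  ⊖-homo zero (suc n) = sym (+-identityˡ _)
  ⊖-homo (suc m) (suc n) = begin
    ⟦ suc m ℤ.⊖ suc n ⟧ℤ                ≡⟨ ≡.cong ⟦_⟧ℤ (ℤP.[1+m]⊖[1+n]≡m⊖n m n) ⟩
    ⟦ m ℤ.⊖ n ⟧ℤ                        ≈⟨ ⊖-homo m n ⟩
    M + - N                              ≈⟨ +-congʳ (+-identityˡ M) ⟨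
    (0# + M) + - N                       ≈⟨ +-congʳ (+-congʳ (-‿inverseʳ 1#)) ⟨
    ((1# + - 1#) + M) + - N              ≈⟨ +-congʳ (+-assoc 1# (- 1#) M) ⟩
    (1# + (- 1# + M)) + - N              ≈⟨ +-congʳ (+-congˡ (+-comm (- 1#) M)) ⟩
    (1# + (M + - 1#)) + - N              ≈⟨ +-congʳ (+-assoc 1# M (- 1#)) ⟨
    ((1# + M) + - 1#) + - N              ≈⟨ +-assoc (1# + M) (- 1#) (- N) ⟩
    (1# + M) + (- 1# + - N)              ≈⟨ +-cong (sym (1+× m 1#)) (-‿+-comm 1# N) ⟩
    suc m ⨯ 1# + - (1# + N)              ≈⟨ +-congˡ (-‿cong (1+× n 1#)) ⟨
    suc m ⨯ 1# + - (suc n ⨯ 1#)          ∎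
    where
    M N : Carrier
    M = m ⨯ 1# ; N = n ⨯ 1#

  +-homo : ∀ i j → ⟦ i ℤ.+ j ⟧ℤ ≈ ⟦ i ⟧ℤ + ⟦ j ⟧ℤ
  +-homo (+ m) (+ n) = ×-homo-+ 1# m n
  +-homo (+ m) -[1+ n ] = ⊖-homo m (suc n)
  +-homo -[1+ m ] (+ n) = trans (⊖-homo n (suc m)) (+-comm _ _)
  +-homo -[1+ m ] -[1+ n ] = begin
    - (suc (suc (m ℕ.+ n)) ⨯ 1#)        ≡⟨ ≡.cong (λ k → - (suc k ⨯ 1#)) (ℕP.+-suc m n) ⟨
    - ((suc m ℕ.+ suc n) ⨯ 1#)          ≈⟨ -‿cong (×-homo-+ 1# (suc m) (suc n)) ⟩
    - (suc m ⨯ 1# + suc n ⨯ 1#)         ≈⟨ -‿+-comm _ _ ⟨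
    - (suc m ⨯ 1#) + - (suc n ⨯ 1#)     ∎

  *-homo-+ : ∀ m j → ⟦ + m ℤ.* j ⟧ℤ ≈ ⟦ + m ⟧ℤ * ⟦ j ⟧ℤ
  *-homo-+ m (+ n) = trans (reflexive (≡.cong ⟦_⟧ℤ (≡.sym (ℤP.pos-* m n)))) (×1-homo-* m n)
  *-homo-+ m -[1+ n ] = begin
    ⟦ + m ℤ.* ℤ.- + suc n ⟧ℤ            ≡⟨ ≡.cong ⟦_⟧ℤ (ℤP.neg-distribʳ-* (+ m) (+ suc n)) ⟨
    ⟦ ℤ.- (+ m ℤ.* + suc n) ⟧ℤ          ≈⟨ -‿homo (+ m ℤ.* + suc n) ⟩
    - ⟦ + m ℤ.* + suc n ⟧ℤ              ≈⟨ -‿cong (*-homo-+ m (+ suc n)) ⟩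
    - (⟦ + m ⟧ℤ * ⟦ + suc n ⟧ℤ)         ≈⟨ -‿distribʳ-* _ _ ⟩
    ⟦ + m ⟧ℤ * - ⟦ + suc n ⟧ℤ           ∎

  *-homo : ∀ i j → ⟦ i ℤ.* j ⟧ℤ ≈ ⟦ i ⟧ℤ * ⟦ j ⟧ℤ
  *-homo (+ m) j = *-homo-+ m j
  *-homo -[1+ m ] j = begin
    ⟦ ℤ.- + suc m ℤ.* j ⟧ℤ              ≡⟨ ≡.cong ⟦_⟧ℤ (ℤP.neg-distribˡ-* (+ suc m) j) ⟨
    ⟦ ℤ.- (+ suc m ℤ.* j) ⟧ℤ            ≈⟨ -‿homo (+ suc m ℤ.* j) ⟩
    - ⟦ + suc m ℤ.* j ⟧ℤ                ≈⟨ -‿cong (*-homo-+ (suc m) j) ⟩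
    - (⟦ + suc m ⟧ℤ * ⟦ j ⟧ℤ)           ≈⟨ -‿distribˡ-* _ _ ⟩
    - ⟦ + suc m ⟧ℤ * ⟦ j ⟧ℤ             ∎

  ℤ⟶R : ℤ.+-*-rawRing -Raw-AlmostCommutative⟶ fromCommutativeRing R
  ℤ⟶R = record
    { ⟦_⟧ = ⟦_⟧ℤ ; +-homo = +-homo ; *-homo = *-homo ; -‿homo = -‿homo
    ; 0-homo = refl ; 1-homo = refl }

  _≟ℤ_ : ∀ i j → Maybe (⟦ i ⟧ℤ ≈ ⟦ j ⟧ℤ)
  i ≟ℤ j with i ℤ.≟ j
  ... | yes ≡.refl = just refl
  ... | no _ = nothing

  open import Algebra.Solver.Ring ℤ.+-*-rawRing (fromCommutativeRing R) ℤ⟶R _≟ℤ_ public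

  expressions : ℕ → RawRing _ _
  expressions n = record
    { Carrier = Polynomial n ; _≈_ = _≡_ ; _+_ = _:+_ ; _*_ = _:*_ ; -_ = :-_
    ; 0# = con (+ 0) ; 1# = con (+ 1) }

  x₁ : ∀ {n} → Polynomial (1 ℕ.+ n)
  x₁ = var zero
  x₂ : ∀ {n} → Polynomial (2 ℕ.+ n)
  x₂ = var (suc zero)
  x₃ : ∀ {n} → Polynomial (3 ℕ.+ n)
  x₃ = var (suc (suc zero))
  x₄ : ∀ {n} → Polynomial (4 ℕ.+ n)
  x₄ = var (suc (suc (suc zero)))
  x₅ : ∀ {n} → Polynomial (5 ℕ.+ n)
  x₅ = var (suc (suc (suc (suc zero))))
  x₆ : ∀ {n} → Polynomial (6 ℕ.+ n)
  x₆ = var (suc (suc (suc (suc (suc zero)))))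
  x₇ : ∀ {n} → Polynomial (7 ℕ.+ n)
  x₇ = var (suc (suc (suc (suc (suc (suc zero))))))

-- The matrices of the paper over an arbitrary raw ring.  Instantiated in
-- F they define the normal form M a b k of the elements of P; instantiated
-- in the ring of polynomial expressions they are the terms handed to the
-- ring solver.
module Shapes {r ℓ : Level} (R : RawRing r ℓ) where
  open RawRing R

  Vector Matrix : Set r
  Vector = Fin 4 → Carrier
  Matrix = Fin 4 → Fin 4 → Carrier

  vec : Carrier → Carrier → Carrier → Carrier → Vector
  vec x₁ x₂ x₃ x₄ zero                   = x₁
  vec x₁ x₂ x₃ x₄ (suc zero)             = x₂
  vec x₁ x₂ x₃ x₄ (suc (suc zero))       = x₃
  vec x₁ x₂ x₃ x₄ (suc (suc (suc zero))) = x₄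

  rows : Vector → Vector → Vector → Vector → Matrix
  rows r₁ r₂ r₃ r₄ zero                   = r₁
  rows r₁ r₂ r₃ r₄ (suc zero)             = r₂
  rows r₁ r₂ r₃ r₄ (suc (suc zero))       = r₃
  rows r₁ r₂ r₃ r₄ (suc (suc (suc zero))) = r₄

  sum : (Fin 4 → Carrier) → Carrier
  sum g = g zero + (g (suc zero) + (g (suc (suc zero)) + (g (suc (suc (suc zero))) + 0#)))

  _·ᵥ_ : Vector → Matrix → Vector
  (v ·ᵥ A) j = sum (λ i → v i * A i j)

  _·ₘ_ : Matrix → Matrix → Matrix
  (A ·ₘ B) i j = sum (λ k → A i k * B k j)

  I : Matrix
  I = rows (vec 1# 0# 0# 0#) (vec 0# 1# 0# 0#) (vec 0# 0# 1# 0#) (vec 0# 0# 0# 1#)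

  t : Carrier → Carrier → Carrier → Matrix
  t a b c = rows (vec 1# 0# 0# 0#) (vec (- c) 1# 0# 0#) (vec b 0# 1# 0#) (vec a b c 1#)

  θ : Carrier → Matrix
  θ k = rows (vec 1# 0# 0# 0#) (vec (- k) 1# 0# 0#) (vec (- (k * k)) k 1# 0#) (vec 0# 0# k 1#)

  β : Vector → Vector → Carrier
  β x y = ((x zero * y (suc (suc (suc zero)))) + - (y zero * x (suc (suc (suc zero)))))
        + ((x (suc zero) * y (suc (suc zero))) + - (y (suc zero) * x (suc (suc zero))))

  -- M a b k = t_{a,b,0} θ_k: every element of P has this form.
  M : Carrier → Carrier → Carrier → Matrix
  M a b k = rows (vec 1# 0# 0# 0#) (vec (- k) 1# 0# 0#)
                 (vec (b + - (k * k)) k 1# 0#) (vec (a + - (k * b)) b k 1#)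

  image : Vector → Carrier → Carrier → Carrier → Vector
  image y a b k = vec (y zero + - (k * y (suc zero)) + (b + - (k * k)) * y (suc (suc zero))
                         + (a + - (k * b)) * y (suc (suc (suc zero))))
                      (y (suc zero) + k * y (suc (suc zero)) + b * y (suc (suc (suc zero))))
                      (y (suc (suc zero)) + k * y (suc (suc (suc zero))))
                      (y (suc (suc (suc zero))))

  mulA mulB : Carrier → Carrier → Carrier → Carrier → Carrier → Carrier → Carrier
  mulA a b k a′ b′ k′ = a + a′ + (k + k) * b′ + k * k * k′
  mulB a b k a′ b′ k′ = b + b′ + k * k′

  invA invB : Carrier → Carrier → Carrier → Carrier
  invA a b k = - a + (k + k) * b + - (k * k * k)
  invB a b k = - b + k * k

  M⁻¹ : Carrier → Carrier → Carrier → Matrix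
  M⁻¹ a b k = M (invA a b k) (invB a b k) (- k)

module NormalForm {c ℓ : Level} (F : CommutativeRing c ℓ) where
  open CommutativeRing F hiding (zero)
  open Over F
  open IntegerSolver F
  open Shapes rawRing public using (M; M⁻¹; image; mulA; mulB)
  module E {n : ℕ} = Shapes (expressions n)
  open import Data.Vec.Functional.Relation.Binary.Equality.Setoid setoid public
    using (≋-setoid) renaming (≋-refl to ≈ᵥ-refl; ≋-sym to ≈ᵥ-sym; ≋-trans to ≈ᵥ-trans)
  open import Data.Vec.Functional.Relation.Binary.Equality.Setoid (≋-setoid 4) public
    using () renaming (≋-refl to ≈ₘ-refl; ≋-sym to ≈ₘ-sym; ≋-trans to ≈ₘ-trans)
  module ≈ᵥ-Reasoning = Relation.Binary.Reasoning.Setoid (≋-setoid 4)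

  proveVec : ∀ {n} (ρ : Vec Carrier n) (L R : Fin 4 → Polynomial n) →
             Every4 (λ i → ⟦ L i ⟧↓ ρ ≡ ⟦ R i ⟧↓ ρ) → Every4 (λ i → ⟦ L i ⟧ ρ ≈ ⟦ R i ⟧ ρ)
  proveVec ρ L R = map4 (λ {i} e → prove ρ (L i) (R i) (reflexive e))

  proveMat : ∀ {n} (ρ : Vec Carrier n) (L R : Fin 4 → Fin 4 → Polynomial n) →
             Every4 (λ i → Every4 (λ j → ⟦ L i j ⟧↓ ρ ≡ ⟦ R i j ⟧↓ ρ)) →
             Every4 (λ i → Every4 (λ j → ⟦ L i j ⟧ ρ ≈ ⟦ R i j ⟧ ρ))
  proveMat ρ L R = map4 (λ {i} → proveVec ρ (L i) (R i))

  byEntries : ∀ {A B : Mat} → Every4 (λ i → Every4 (λ j → A i j ≈ B i j)) → A ≈ₘ B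
  byEntries {A} {B} e i = every4 (every4 {P = λ i → Every4 (λ j → A i j ≈ B i j)} e i)

  M-cong : ∀ {a a′ b b′ k k′} → a ≈ a′ → b ≈ b′ → k ≈ k′ → M a b k ≈ₘ M a′ b′ k′
  M-cong ea eb ek = byEntries
    ( (refl , refl , refl , refl)
    , (-‿cong ek , refl , refl , refl)
    , (+-cong eb (-‿cong (*-cong ek ek)) , ek , refl , refl)
    , (+-cong ea (-‿cong (*-cong ek eb)) , eb , ek , refl) )

  sum4-cong : ∀ {g h : Fin 4 → Carrier} → (∀ i → g i ≈ h i) → sum4 g ≈ sum4 h
  sum4-cong e = +-cong (e i₁) (+-cong (e i₂) (+-cong (e i₃) (+-cong (e i₄) refl)))

  ·ᵥ-cong : ∀ {u u′ A A′} → u ≈ᵥ u′ → A ≈ₘ A′ → (u ·ᵥ A) ≈ᵥ (u′ ·ᵥ A′)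
  ·ᵥ-cong eu eA j = sum4-cong (λ i → *-cong (eu i) (eA i j))

  ·ᵥ-congʳ : ∀ u {A A′} → A ≈ₘ A′ → (u ·ᵥ A) ≈ᵥ (u ·ᵥ A′)
  ·ᵥ-congʳ u = ·ᵥ-cong (≈ᵥ-refl {x = u})

  ·ᵥ-congˡ : ∀ {u u′} A → u ≈ᵥ u′ → (u ·ᵥ A) ≈ᵥ (u′ ·ᵥ A)
  ·ᵥ-congˡ A eu = ·ᵥ-cong eu (≈ₘ-refl {x = A})

  ·ₘ-cong : ∀ {A A′ B B′} → A ≈ₘ A′ → B ≈ₘ B′ → (A ·ₘ B) ≈ₘ (A′ ·ₘ B′)
  ·ₘ-cong eA eB i = ·ᵥ-cong (eA i) eB

  act : ∀ y a b k → (y ·ᵥ M a b k) ≈ᵥ image y a b k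
  act y a b k = every4 (proveVec (y i₁ ∷ y i₂ ∷ y i₃ ∷ y i₄ ∷ a ∷ b ∷ k ∷ [])
    (E._·ᵥ_ (E.vec x₁ x₂ x₃ x₄) (E.M x₅ x₆ x₇)) (E.image (E.vec x₁ x₂ x₃ x₄) x₅ x₆ x₇) refl⁴)

  M-mul : ∀ a b k a′ b′ k′ → (M a b k ·ₘ M a′ b′ k′) ≈ₘ M (mulA a b k a′ b′ k′) (mulB a b k a′ b′ k′) (k + k′)
  M-mul a b k a′ b′ k′ = byEntries (proveMat (a ∷ b ∷ k ∷ a′ ∷ b′ ∷ k′ ∷ [])
    (E._·ₘ_ (E.M x₁ x₂ x₃) (E.M x₄ x₅ x₆)) (E.M (E.mulA x₁ x₂ x₃ x₄ x₅ x₆) (E.mulB x₁ x₂ x₃ x₄ x₅ x₆) (x₃ :+ x₆)) refl⁴ˣ⁴)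

  t-as-M : ∀ a b → t a b 0# ≈ₘ M a b 0#
  t-as-M a b = byEntries (proveMat (a ∷ b ∷ []) (E.t x₁ x₂ (con (+ 0))) (E.M x₁ x₂ (con (+ 0))) refl⁴ˣ⁴)

  θ-as-M : ∀ k → θ k ≈ₘ M 0# 0# k
  θ-as-M k = byEntries (proveMat (k ∷ []) (E.θ x₁) (E.M (con (+ 0)) (con (+ 0)) x₁) refl⁴ˣ⁴)

  I-as-M : Iₘ ≈ₘ M 0# 0# 0#
  I-as-M = byEntries (proveMat [] E.I (E.M (con (+ 0)) (con (+ 0)) (con (+ 0))) refl⁴ˣ⁴)

  I-unit : ∀ a b k → (Iₘ ·ₘ M a b k) ≈ₘ M a b k
  I-unit a b k = byEntries (proveMat (a ∷ b ∷ k ∷ []) (E._·ₘ_ E.I (E.M x₁ x₂ x₃)) (E.M x₁ x₂ x₃) refl⁴ˣ⁴)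

  M-cancel : ∀ v a b k → ((v ·ᵥ M a b k) ·ᵥ M⁻¹ a b k) ≈ᵥ v
  M-cancel v a b k = every4 (proveVec (v i₁ ∷ v i₂ ∷ v i₃ ∷ v i₄ ∷ a ∷ b ∷ k ∷ [])
    (E._·ᵥ_ (E._·ᵥ_ vₑ (E.M x₅ x₆ x₇)) (E.M⁻¹ x₅ x₆ x₇)) vₑ refl⁴)
    where
    vₑ : Fin 4 → Polynomial 7
    vₑ = E.vec x₁ x₂ x₃ x₄

  act′ : ∀ {g a b k} y → g ≈ₘ M a b k → (y ·ᵥ g) ≈ᵥ image y a b k
  act′ y g≈ = ≈ᵥ-trans (·ᵥ-congʳ y g≈) (act y _ _ _)

  image-cong : ∀ y {a a′ b b′ k k′} → a ≈ a′ → b ≈ b′ → k ≈ k′ → image y a b k ≈ᵥ image y a′ b′ k′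
  image-cong y ea eb ek = ≈ᵥ-trans (≈ᵥ-sym (act y _ _ _)) (act′ y (M-cong ea eb ek))

  -- a left inverse of M a b k is M⁻¹ a b k (rowwise: Bᵢ = (Bᵢ M) M⁻¹ = eᵢ M⁻¹)
  leftInverse : ∀ {A B} a b k → A ≈ₘ M a b k → (B ·ₘ A) ≈ₘ Iₘ → B ≈ₘ M⁻¹ a b k
  leftInverse {A} {B} a b k A≈M BA≈I i = begin
    B i                               ≈⟨ M-cancel (B i) a b k ⟨
    (B i ·ᵥ M a b k) ·ᵥ M⁻¹ a b k      ≈⟨ ·ᵥ-congˡ (M⁻¹ a b k) (·ᵥ-congʳ (B i) (≈ₘ-sym A≈M)) ⟩
    (B i ·ᵥ A) ·ᵥ M⁻¹ a b k            ≈⟨ ·ᵥ-congˡ (M⁻¹ a b k) (BA≈I i) ⟩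
    Iₘ i ·ᵥ M⁻¹ a b k                  ≈⟨ I-unit _ _ _ i ⟩
    M⁻¹ a b k i                       ∎
    where open ≈ᵥ-Reasoning

  InM : Mat → Set (c ⊔ ℓ)
  InM g = ∃[ a ] ∃[ b ] ∃[ k ] (g ≈ₘ M a b k)

  normalForm : ∀ {f} {α : Fin f → Carrier} {g} → InP α g → InM g
  normalForm (genR a b)      = a , b , 0# , t-as-M a b
  normalForm {α = α} (genθ i) = 0# , 0# , α i , θ-as-M (α i)
  normalForm one             = 0# , 0# , 0# , I-as-M
  normalForm (mul p q) with normalForm p | normalForm q
  ... | a , b , k , A≈ | a′ , b′ , k′ , B≈ = _ , _ , _ , ≈ₘ-trans (·ₘ-cong A≈ B≈) (M-mul a b k a′ b′ k′)
  normalForm (inv p _ BA≈I) with normalForm p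
  ... | a , b , k , A≈ = _ , _ , _ , leftInverse a b k A≈ BA≈I
  normalForm (resp p A≈B) with normalForm p
  ... | a , b , k , A≈ = a , b , k , ≈ₘ-trans (≈ₘ-sym A≈B) A≈

  lc : Carrier → V → Carrier → V → V
  lc a u b w = (a ∙ᵥ u) +ᵥ (b ∙ᵥ w)

  lc-cong : ∀ {a b q q′ r r′} → q ≈ᵥ q′ → r ≈ᵥ r′ → lc a q b r ≈ᵥ lc a q′ b r′
  lc-cong eq er i = +-cong (*-congˡ (eq i)) (*-congˡ (er i))

  lc-vanish : ∀ a b {x y} → x ≈ 0# → y ≈ 0# → a * x + b * y ≈ 0#
  lc-vanish a b x≈0 y≈0 = trans (+-cong (*-congˡ x≈0) (*-congˡ y≈0))
    (solve 2 (λ a b → a :* con (+ 0) :+ b :* con (+ 0) := con (+ 0)) refl a b)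

  ·ᵥ-linear : ∀ a u b w g → (lc a u b w ·ᵥ g) ≈ᵥ lc a (u ·ᵥ g) b (w ·ᵥ g)
  ·ᵥ-linear a u b w g j = solve 14 (λ a b u₁ u₂ u₃ u₄ w₁ w₂ w₃ w₄ g₁ g₂ g₃ g₄ →
      let uₑ = E.vec u₁ u₂ u₃ u₄ ; wₑ = E.vec w₁ w₂ w₃ w₄ ; G = λ (i _ : Fin 4) → E.vec g₁ g₂ g₃ g₄ i
      in E._·ᵥ_ (λ i → a :* uₑ i :+ b :* wₑ i) G zero := a :* E._·ᵥ_ uₑ G zero :+ b :* E._·ᵥ_ wₑ G zero)
    refl a b (u i₁) (u i₂) (u i₃) (u i₄) (w i₁) (w i₂) (w i₃) (w i₄) (g i₁ j) (g i₂ j) (g i₃ j) (g i₄ j)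

  ·ᵥ-zeroˡ : ∀ g → (0ᵥ ·ᵥ g) ≈ᵥ 0ᵥ
  ·ᵥ-zeroˡ g j = solve 4 (λ g₁ g₂ g₃ g₄ →
      E._·ᵥ_ (λ _ → con (+ 0)) (λ i _ → E.vec g₁ g₂ g₃ g₄ i) zero := con (+ 0))
    refl (g i₁ j) (g i₂ j) (g i₃ j) (g i₄ j)

  -- having the left inverse M⁻¹ a b k, a matrix in normal form is injective on vectors
  M-injective : ∀ {g a b k} v → g ≈ₘ M a b k → (v ·ᵥ g) ≈ᵥ 0ᵥ → v ≈ᵥ 0ᵥ
  M-injective {g} {a} {b} {k} v g≈ vg≈0 = begin
    v                              ≈⟨ M-cancel v a b k ⟨
    (v ·ᵥ M a b k) ·ᵥ M⁻¹ a b k    ≈⟨ ·ᵥ-congˡ (M⁻¹ a b k) (·ᵥ-congʳ v (≈ₘ-sym g≈)) ⟩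
    (v ·ᵥ g) ·ᵥ M⁻¹ a b k          ≈⟨ ·ᵥ-congˡ (M⁻¹ a b k) vg≈0 ⟩
    0ᵥ ·ᵥ M⁻¹ a b k                ≈⟨ ·ᵥ-zeroˡ (M⁻¹ a b k) ⟩
    0ᵥ                             ∎
    where open ≈ᵥ-Reasoning

  -- when y₄ is invertible, some M a b k moves y to any w with w₄ = y₄
  -- (solve the triangular system for k, then b, then a)
  image-onto : ∀ y w {d} → y i₄ * d ≈ 1# → w i₄ ≈ y i₄ → ∃[ a ] ∃[ b ] ∃[ k ] (image y a b k ≈ᵥ w)
  image-onto y w {d} y₄d≈1 w₄≈y₄ = a , b , k , every4 (first , fix (y i₂ + k * y i₃) (w i₂) , fix (y i₃) (w i₃) , sym w₄≈y₄)
    where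
    open Relation.Binary.Reasoning.Setoid setoid
    fix : ∀ X T → X + ((T − X) * d) * y i₄ ≈ T
    fix X T = begin
      X + ((T − X) * d) * y i₄  ≈⟨ solve 4 (λ X T d y₄ → X :+ ((T :- X) :* d) :* y₄ := X :+ (T :- X) :* (y₄ :* d))
                                      refl X T d (y i₄) ⟩
      X + (T − X) * (y i₄ * d)  ≈⟨ +-congˡ (*-congˡ y₄d≈1) ⟩
      X + (T − X) * 1#          ≈⟨ solve 2 (λ X T → X :+ (T :- X) :* con (+ 1) := T) refl X T ⟩
      T                         ∎
    k b X₁ a : Carrier
    k = (w i₃ − y i₃) * d
    b = (w i₂ − (y i₂ + k * y i₃)) * d
    X₁ = y i₁ + - (k * y i₂) + (b + - (k * k)) * y i₃
    a = (w i₁ − X₁) * d + k * b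
    first : X₁ + (a + - (k * b)) * y i₄ ≈ w i₁
    first = trans (+-congˡ (*-congʳ (solve 2 (λ Q P → (Q :+ P) :- P := Q) refl ((w i₁ − X₁) * d) (k * b))))
                  (fix X₁ (w i₁))

module Quadrangle {c ℓ : Level} (F : CommutativeRing c ℓ) where
  open CommutativeRing F hiding (zero)
  open Over F
  open IntegerSolver F
  open NormalForm F

  β-cong : ∀ {x x′ y y′} → x ≈ᵥ x′ → y ≈ᵥ y′ → β x y ≈ β x′ y′
  β-cong ex ey = +-cong (+-cong (*-cong (ex i₁) (ey i₄)) (-‿cong (*-cong (ey i₁) (ex i₄))))
                        (+-cong (*-cong (ex i₂) (ey i₃)) (-‿cong (*-cong (ey i₂) (ex i₃))))

  β-image : ∀ y z a b k → β (image y a b k) (image z a b k) ≈ β y z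
  β-image y z a b k = solve 11 (λ y₁ y₂ y₃ y₄ z₁ z₂ z₃ z₄ a b k →
      let yₑ = E.vec y₁ y₂ y₃ y₄ ; zₑ = E.vec z₁ z₂ z₃ z₄
      in E.β (E.image yₑ a b k) (E.image zₑ a b k) := E.β yₑ zₑ)
    refl (y i₁) (y i₂) (y i₃) (y i₄) (z i₁) (z i₂) (z i₃) (z i₄) a b k

  β-preserved : ∀ {g a b k} y z → g ≈ₘ M a b k → β (y ·ᵥ g) (z ·ᵥ g) ≈ β y z
  β-preserved y z g≈ = trans (β-cong (act′ y g≈) (act′ z g≈)) (β-image y z _ _ _)

  β-self : ∀ y → β y y ≈ 0#
  β-self y = solve 4 (λ y₁ y₂ y₃ y₄ → E.β (E.vec y₁ y₂ y₃ y₄) (E.vec y₁ y₂ y₃ y₄) := con (+ 0))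
    refl (y i₁) (y i₂) (y i₃) (y i₄)

  𝐱ₑ : ∀ {n} → Fin 4 → Polynomial n
  𝐱ₑ = E.vec (con (+ 1)) (con (+ 0)) (con (+ 0)) (con (+ 0))

  β-𝐱 : ∀ y → β 𝐱 y ≈ y i₄
  β-𝐱 y = solve 4 (λ y₁ y₂ y₃ y₄ → E.β 𝐱ₑ (E.vec y₁ y₂ y₃ y₄) := y₄) refl (y i₁) (y i₂) (y i₃) (y i₄)

  𝐱-fixed : ∀ {g a b k} → g ≈ₘ M a b k → (𝐱 ·ᵥ g) ≈ᵥ 𝐱
  𝐱-fixed {a = a} {b} {k} g≈ =
    ≈ᵥ-trans (act′ 𝐱 g≈) (every4 (proveVec (a ∷ b ∷ k ∷ []) (E.image 𝐱ₑ x₁ x₂ x₃) 𝐱ₑ refl⁴))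

  onLine-resp : ∀ {q r L} → q ≈ᵥ r → OnLine q L → OnLine r L
  onLine-resp q≈r (a , b , q≈) = a , b , ≈ᵥ-trans (≈ᵥ-sym q≈r) q≈

  onLine-u : ∀ L → OnLine (u L) L
  onLine-u L = 1# , 0# , λ i → solve 2 (λ x y → x := con (+ 1) :* x :+ con (+ 0) :* y) refl (u L i) (w L i)

  onLine-w : ∀ L → OnLine (w L) L
  onLine-w L = 0# , 1# , λ i → solve 2 (λ x y → y := con (+ 0) :* x :+ con (+ 1) :* y) refl (u L i) (w L i)

  onLine-lc : ∀ {q r L} c d → OnLine q L → OnLine r L → OnLine (lc c q d r) L
  onLine-lc {L = L} c d (a , b , q≈) (a′ , b′ , r≈) =
    c * a + d * a′ , c * b + d * b′ , ≈ᵥ-trans (lc-cong q≈ r≈) collect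
    where
    collect : lc c (lc a (u L) b (w L)) d (lc a′ (u L) b′ (w L)) ≈ᵥ lc (c * a + d * a′) (u L) (c * b + d * b′) (w L)
    collect i = solve 8 (λ c d a b a′ b′ x y →
        c :* (a :* x :+ b :* y) :+ d :* (a′ :* x :+ b′ :* y) := (c :* a :+ d :* a′) :* x :+ (c :* b :+ d :* b′) :* y)
      refl c d a b a′ b′ (u L i) (w L i)

  sameLine-spans : ∀ {L L′} → OnLine (u L) L′ → OnLine (w L) L′ → OnLine (u L′) L → OnLine (w L′) L →
                   SameLine L L′
  sameLine-spans uL′ wL′ uL wL q =
    (λ (a , b , q≈) → onLine-resp (≈ᵥ-sym q≈) (onLine-lc a b uL′ wL′)) ,
    (λ (a , b , q≈) → onLine-resp (≈ᵥ-sym q≈) (onLine-lc a b uL wL))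

  sameLine-≈ : ∀ {u u′ w w′} → u ≈ᵥ u′ → w ≈ᵥ w′ → SameLine ⟨ u , w ⟩ ⟨ u′ , w′ ⟩
  sameLine-≈ eu ew = sameLine-spans (onLine-resp (≈ᵥ-sym eu) (onLine-u _)) (onLine-resp (≈ᵥ-sym ew) (onLine-w _))
                                    (onLine-resp eu (onLine-u _)) (onLine-resp ew (onLine-w _))

  sameLine-sym : ∀ {L L′} → SameLine L L′ → SameLine L′ L
  sameLine-sym same q = proj₂ (same q) , proj₁ (same q)

  sameLine-trans : ∀ {L L′ L″} → SameLine L L′ → SameLine L′ L″ → SameLine L L″
  sameLine-trans same same′ q = (λ h → proj₁ (same′ q) (proj₁ (same q) h)) , (λ h → proj₂ (same q) (proj₂ (same′ q) h))

  shear : ∀ c u v → SameLine ⟨ u , (c ∙ᵥ u) +ᵥ v ⟩ ⟨ u , v ⟩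
  shear c u v = sameLine-spans (onLine-u ⟨ u , v ⟩) (c , 1# , λ i → add i) (onLine-u _) (- c , 1# , λ i → sub i)
    where
    add : ∀ i → c * u i + v i ≈ c * u i + 1# * v i
    add i = solve 3 (λ c x y → c :* x :+ y := c :* x :+ con (+ 1) :* y) refl c (u i) (v i)
    sub : ∀ i → v i ≈ - c * u i + 1# * (c * u i + v i)
    sub i = solve 3 (λ c x y → y := :- c :* x :+ con (+ 1) :* (c :* x :+ y)) refl c (u i) (v i)

  onLine-image : ∀ {q L} g → OnLine q L → OnLine (q ·ᵥ g) (L ^ₗ g)
  onLine-image {L = L} g (a , b , q≈) = a , b , ≈ᵥ-trans (·ᵥ-congˡ g q≈) (·ᵥ-linear a (u L) b (w L) g)

  sameLine-image : ∀ {L L′} g → SameLine L L′ → SameLine (L ^ₗ g) (L′ ^ₗ g)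
  sameLine-image {L} {L′} g same = sameLine-spans
    (onLine-image g (proj₁ (same _) (onLine-u L))) (onLine-image g (proj₁ (same _) (onLine-w L)))
    (onLine-image g (proj₂ (same _) (onLine-u L′))) (onLine-image g (proj₂ (same _) (onLine-w L′)))

  isotropic : ∀ {L q r} → IsLine L → OnLine q L → OnLine r L → β q r ≈ 0#
  isotropic (_ , iso) (a , b , q≈) (a′ , b′ , r≈) = trans (β-cong q≈ r≈) (iso a b a′ b′)

  -- being injective and β-preserving, P maps lines of W(3,q) to lines of W(3,q)
  isLine-image : ∀ {L g a b k} → g ≈ₘ M a b k → IsLine L → IsLine (L ^ₗ g)
  isLine-image {L} {g} g≈ (indep , iso) = indep′ , iso′
    where
    fromImage : ∀ a b → lc a (u L ·ᵥ g) b (w L ·ᵥ g) ≈ᵥ (lc a (u L) b (w L) ·ᵥ g)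
    fromImage a b = ≈ᵥ-sym (·ᵥ-linear a (u L) b (w L) g)
    indep′ : LinIndep (u L ·ᵥ g) (w L ·ᵥ g)
    indep′ a b e = indep a b (M-injective _ g≈ (≈ᵥ-trans (≈ᵥ-sym (fromImage a b)) e))
    iso′ : ∀ a b a′ b′ → β (lc a (u L ·ᵥ g) b (w L ·ᵥ g)) (lc a′ (u L ·ᵥ g) b′ (w L ·ᵥ g)) ≈ 0#
    iso′ a b a′ b′ = trans (β-cong (fromImage a b) (fromImage a′ b′)) (trans (β-preserved (lc a (u L) b (w L)) (lc a′ (u L) b′ (w L)) g≈) (iso a b a′ b′))

  -- every point on a line through x lies in x^⊥, i.e. has fourth coordinate 0
  throughX-perp : ∀ {L q} → IsLine L → OnLine 𝐱 L → OnLine q L → q i₄ ≈ 0#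
  throughX-perp {q = q} isL x∈L q∈L = trans (sym (β-𝐱 q)) (isotropic isL x∈L q∈L)

  flat : Carrier → Carrier → V
  flat s t = vec4 0# s t 0#

  otherLine : Carrier → Line
  otherLine s = ⟨ 𝐱 , flat s 1# ⟩

  flat-cong : ∀ {s s′ t t′} → s ≈ s′ → t ≈ t′ → flat s t ≈ᵥ flat s′ t′
  flat-cong es et = every4 (refl , es , et , refl)

  flat-image : ∀ {g a b k} s t → g ≈ₘ M a b k →
               (flat s t ·ᵥ g) ≈ᵥ (((- (k * s) + (b − (k * k)) * t) ∙ᵥ 𝐱) +ᵥ flat (s + k * t) t)
  flat-image {a = a} {b} {k} s t g≈ = ≈ᵥ-trans (act′ (flat s t) g≈) (every4 (proveVec (s ∷ t ∷ a ∷ b ∷ k ∷ [])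
    (E.image (flatₑ x₁ x₂) x₃ x₄ x₅) (λ i → (:- (x₅ :* x₁) :+ (x₄ :- x₅ :* x₅) :* x₂) :* 𝐱ₑ i :+ flatₑ (x₁ :+ x₅ :* x₂) x₂ i)
    refl⁴))
    where
    flatₑ : ∀ {n} → Polynomial n → Polynomial n → Fin 4 → Polynomial n
    flatₑ s t = E.vec (con (+ 0)) s t (con (+ 0))

  flatLine-image : ∀ {g a b k} s t → g ≈ₘ M a b k → SameLine (⟨ 𝐱 , flat s t ⟩ ^ₗ g) ⟨ 𝐱 , flat (s + k * t) t ⟩
  flatLine-image s t g≈ = sameLine-trans (sameLine-≈ (𝐱-fixed g≈) (flat-image s t g≈)) (shear _ 𝐱 _)

  -- hence P fixes L₀ (s = 1, t = 0) and shifts otherLine s to otherLine (s + k)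
  L₀-fixed : ∀ {g a b k} → g ≈ₘ M a b k → SameLine (L₀ ^ₗ g) L₀
  L₀-fixed {k = k} g≈ = sameLine-trans (flatLine-image 1# 0# g≈)
    (sameLine-≈ ≈ᵥ-refl (flat-cong (trans (+-congˡ (zeroʳ k)) (+-identityʳ 1#)) refl))

  otherLine-cong : ∀ {s s′} → s ≈ s′ → SameLine (otherLine s) (otherLine s′)
  otherLine-cong e = sameLine-≈ ≈ᵥ-refl (flat-cong e refl)

  otherLine-shift : ∀ {g a b k} s → g ≈ₘ M a b k → SameLine (otherLine s ^ₗ g) (otherLine (s + k))
  otherLine-shift {k = k} s g≈ = sameLine-trans (flatLine-image s 1# g≈) (otherLine-cong (+-congˡ (*-identityʳ k)))

  L₀-third : ∀ {q} → OnLine q L₀ → q i₃ ≈ 0#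
  L₀-third (a , b , q≈) = trans (q≈ i₃) (lc-vanish a b refl refl)

  otherLine-injective : ∀ {s s′} → SameLine (otherLine s) (otherLine s′) → s ≈ s′
  otherLine-injective {s} {s′} same with proj₁ (same (flat s 1#)) (onLine-w (otherLine s))
  ... | a , b , q≈ = begin
    s                          ≈⟨ q≈ i₂ ⟩
    a * 0# + b * s′            ≈⟨ solve 3 (λ a b s′ → a :* con (+ 0) :+ b :* s′ := b :* s′) refl a b s′ ⟩
    b * s′                     ≈⟨ *-congʳ b≈1 ⟩
    1# * s′                    ≈⟨ *-identityˡ s′ ⟩
    s′                         ∎
    where
    open Relation.Binary.Reasoning.Setoid setoid
    b≈1 : b ≈ 1#
    b≈1 = sym (trans (q≈ i₃) (solve 2 (λ a b → a :* con (+ 0) :+ b :* con (+ 1) := b) refl a b))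

  onL₀ : ∀ {q} → q i₃ ≈ 0# → q i₄ ≈ 0# → OnLine q L₀
  onL₀ {q} q₃≈0 q₄≈0 = q i₁ , q i₂ , every4
    ( solve 2 (λ a b → a := a :* con (+ 1) :+ b :* con (+ 0)) refl (q i₁) (q i₂)
    , solve 2 (λ a b → b := a :* con (+ 0) :+ b :* con (+ 1)) refl (q i₁) (q i₂)
    , trans q₃≈0 (sym (lc-vanish (q i₁) (q i₂) refl refl))
    , trans q₄≈0 (sym (lc-vanish (q i₁) (q i₂) refl refl)) )

  projectPoint : ∀ {L r} d → OnLine 𝐱 L → OnLine r L → r i₄ ≈ 0# → OnLine (flat (r i₂ * d) (r i₃ * d)) L
  projectPoint {r = r} d x∈L r∈L r₄≈0 = onLine-resp projection (onLine-lc (- (r i₁ * d)) d x∈L r∈L)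
    where
    projection : lc (- (r i₁ * d)) 𝐱 d r ≈ᵥ flat (r i₂ * d) (r i₃ * d)
    projection = every4
      ( solve 2 (λ r₁ d → :- (r₁ :* d) :* con (+ 1) :+ d :* r₁ := con (+ 0)) refl (r i₁) d
      , solve 3 (λ r₁ r₂ d → :- (r₁ :* d) :* con (+ 0) :+ d :* r₂ := r₂ :* d) refl (r i₁) (r i₂) d
      , solve 3 (λ r₁ r₃ d → :- (r₁ :* d) :* con (+ 0) :+ d :* r₃ := r₃ :* d) refl (r i₁) (r i₃) d
      , lc-vanish (- (r i₁ * d)) d refl r₄≈0 )

module FieldGeometry {c ℓ : Level} (F : CommutativeRing c ℓ) (isField : Over.IsField F)
                     (_≟_ : Decidable (CommutativeRing._≈_ F)) where
  open CommutativeRing F hiding (zero)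
  open Over F
  open IntegerSolver F
  open NormalForm F
  open Quadrangle F
  open import Algebra.Properties.AbelianGroup +-abelianGroup using (identityʳ-unique)
  open Relation.Binary.Reasoning.Setoid setoid

  1≉0 : ¬ 1# ≈ 0#
  1≉0 e = proj₁ isField (sym e)

  cancel : ∀ {d x} → ¬ d ≈ 0# → x * d ≈ 0# → x ≈ 0#
  cancel {d} {x} d≉0 xd≈0 with proj₂ isField d d≉0
  ... | d⁻¹ , dd⁻¹≈1 = begin
    x              ≈⟨ *-identityʳ x ⟨
    x * 1#         ≈⟨ *-congˡ dd⁻¹≈1 ⟨
    x * (d * d⁻¹)  ≈⟨ *-assoc x d d⁻¹ ⟨
    (x * d) * d⁻¹  ≈⟨ *-congʳ xd≈0 ⟩
    0# * d⁻¹       ≈⟨ zeroˡ d⁻¹ ⟩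
    0#             ∎

  isLine-𝐱 : ∀ y → y i₄ ≈ 0# → (¬ y i₂ ≈ 0#) ⊎ (¬ y i₃ ≈ 0#) → IsLine ⟨ 𝐱 , y ⟩
  isLine-𝐱 y y₄≈0 y≉x = independent , isotropic′
    where
    independent : LinIndep 𝐱 y
    independent a b comb≈0 = a≈0 , b≈0
      where
      coefficient : ∀ i → a * 𝐱 i + b * y i ≈ 0# → 𝐱 i ≈ 0# → b * y i ≈ 0#
      coefficient i e xᵢ≈0 = trans (sym (trans (+-congʳ (trans (*-congˡ xᵢ≈0) (zeroʳ a))) (+-identityˡ _))) e
      b≈0 : b ≈ 0#
      b≈0 = [ (λ y₂≉0 → cancel y₂≉0 (coefficient i₂ (comb≈0 i₂) refl))
            , (λ y₃≉0 → cancel y₃≉0 (coefficient i₃ (comb≈0 i₃) refl)) ] y≉x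
      a≈0 : a ≈ 0#
      a≈0 = begin
        a                                     ≈⟨ solve 3 (λ a b y₁ → a := (a :* con (+ 1) :+ b :* y₁) :- b :* y₁) refl a b (y i₁) ⟩
        (a * 1# + b * y i₁) + - (b * y i₁)    ≈⟨ +-cong (comb≈0 i₁) (-‿cong (*-congʳ b≈0)) ⟩
        0# + - (0# * y i₁)                    ≈⟨ solve 1 (λ y₁ → con (+ 0) :- con (+ 0) :* y₁ := con (+ 0)) refl (y i₁) ⟩
        0#                                    ∎
    isotropic′ : ∀ a b a′ b′ → β (lc a 𝐱 b y) (lc a′ 𝐱 b′ y) ≈ 0#
    isotropic′ a b a′ b′ = begin
      β (lc a 𝐱 b y) (lc a′ 𝐱 b′ y)   ≈⟨ solve 8 (λ a b a′ b′ y₁ y₂ y₃ y₄ →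
                                            let yₑ = E.vec y₁ y₂ y₃ y₄
                                                lcₑ = λ a b i → a :* 𝐱ₑ i :+ b :* yₑ i
                                            in E.β (lcₑ a b) (lcₑ a′ b′) := (a :* b′ :- a′ :* b) :* y₄)
                                          refl a b a′ b′ (y i₁) (y i₂) (y i₃) (y i₄) ⟩
      (a * b′ + - (a′ * b)) * y i₄    ≈⟨ *-congˡ y₄≈0 ⟩
      (a * b′ + - (a′ * b)) * 0#      ≈⟨ zeroʳ _ ⟩
      0#                              ∎

  -- each otherLine s is a line through x other than L₀ (it contains (0,s,1,0))
  otherLine-other : ∀ s → OtherLineThroughX (otherLine s)
  otherLine-other s = isLine-𝐱 (flat s 1#) refl (inj₂ 1≉0) , onLine-u _ ,
                      λ same → 1≉0 (L₀-third (proj₁ (same (flat s 1#)) (onLine-w _)))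

  farPoint⇒ : ∀ {y} → FarPoint y → ¬ y i₄ ≈ 0#
  farPoint⇒ {y} (_ , notCollinear) y₄≈0 with y i₃ ≟ 0#
  ... | no y₃≉0 = notCollinear (⟨ 𝐱 , y ⟩ , isLine-𝐱 y y₄≈0 (inj₂ y₃≉0) , onLine-u _ , onLine-w _)
  ... | yes y₃≈0 = notCollinear (L₀ , isLine-𝐱 (flat 1# 0#) refl (inj₁ 1≉0) , onLine-u L₀ , onL₀ y₃≈0 y₄≈0)

  ⇒farPoint : ∀ {y} → ¬ y i₄ ≈ 0# → FarPoint y
  ⇒farPoint {y} y₄≉0 = ((λ y≈0 → y₄≉0 (y≈0 i₄)) , β-self y) ,
                       λ (L , isL , x∈L , y∈L) → y₄≉0 (throughX-perp isL x∈L y∈L)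

  fixesFarPoint : ∀ {y s a b k} → ¬ y i₄ ≈ 0# → y ≈ᵥ (s ∙ᵥ image y a b k) → (a ≈ 0#) × (b ≈ 0#) × (k ≈ 0#)
  fixesFarPoint {y} {s} {a} {b} {k} y₄≉0 y≈ = a≈0 , b≈0 , k≈0
    where
    -- the fourth coordinate gives s = 1; then the third, second and first
    -- coordinates give k = 0, b = 0 and a = 0 in turn, as x = x + t y₄ forces t = 0
    vanish : ∀ {x t} → x ≈ x + t * y i₄ → t ≈ 0#
    vanish e = cancel y₄≉0 (identityʳ-unique _ _ (sym e))
    s≈1 : s ≈ 1#
    s≈1 = begin
      s                   ≈⟨ solve 1 (λ s → s := (s :- con (+ 1)) :+ con (+ 1)) refl s ⟩
      (s − 1#) + 1#       ≈⟨ +-congʳ (vanish (trans (y≈ i₄)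
                               (solve 2 (λ s y₄ → s :* y₄ := y₄ :+ (s :- con (+ 1)) :* y₄) refl s (y i₄)))) ⟩
      0# + 1#             ≈⟨ +-identityˡ 1# ⟩
      1#                  ∎
    fixed : ∀ {a′ b′ k′} → a ≈ a′ → b ≈ b′ → k ≈ k′ → y ≈ᵥ image y a′ b′ k′
    fixed ea eb ek i = trans (y≈ i) (trans (*-congʳ s≈1) (trans (*-identityˡ _) (image-cong y ea eb ek i)))
    k≈0 : k ≈ 0#
    k≈0 = vanish (fixed refl refl refl i₃)
    b≈0 : b ≈ 0#
    b≈0 = vanish (trans (fixed refl refl k≈0 i₂)
      (solve 3 (λ y₂ y₃ t → y₂ :+ con (+ 0) :* y₃ :+ t := y₂ :+ t) refl (y i₂) (y i₃) (b * y i₄)))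
    a≈0 : a ≈ 0#
    a≈0 = vanish (trans (fixed refl b≈0 k≈0 i₁)
      (solve 5 (λ y₁ y₂ y₃ y₄ a → y₁ :- con (+ 0) :* y₂ :+ (con (+ 0) :- con (+ 0) :* con (+ 0)) :* y₃
                                   :+ (a :- con (+ 0) :* con (+ 0)) :* y₄ := y₁ :+ a :* y₄)
        refl (y i₁) (y i₂) (y i₃) (y i₄) a))

  someCoordinate : ∀ L i → (∀ q → OnLine q L → q i ≈ 0#) ⊎ ∃[ q ] (OnLine q L × ¬ q i ≈ 0#)
  someCoordinate L i with u L i ≟ 0# | w L i ≟ 0#
  ... | no uᵢ≉0 | _        = inj₂ (u L , onLine-u L , uᵢ≉0)
  ... | yes _   | no wᵢ≉0  = inj₂ (w L , onLine-w L , wᵢ≉0)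
  ... | yes uᵢ≈0 | yes wᵢ≈0 = inj₁ λ q (a , b , q≈) → trans (q≈ i) (lc-vanish a b uᵢ≈0 wᵢ≈0)

  module _ {L : Line} (isL : IsLine L) (x∈L : OnLine 𝐱 L) where
    private
      perp : ∀ {q} → OnLine q L → q i₄ ≈ 0#
      perp = throughX-perp isL x∈L

    -- β(q, r) = 0 with q₄ = r₄ = 0 reads q₂ r₃ = r₂ q₃
    cross : ∀ {q r} → OnLine q L → OnLine r L → q i₂ * r i₃ ≈ r i₂ * q i₃
    cross {q} {r} q∈L r∈L = begin
      q₂ * r₃                                          ≈⟨ solve 8 (λ q₁ q₂ q₃ q₄ r₁ r₂ r₃ r₄ →
                                                            q₂ :* r₃ := (E.β (E.vec q₁ q₂ q₃ q₄) (E.vec r₁ r₂ r₃ r₄)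
                                                                         :- (q₁ :* r₄ :- r₁ :* q₄)) :+ r₂ :* q₃)
                                                          refl q₁ q₂ q₃ (q i₄) r₁ r₂ r₃ (r i₄) ⟩
      (β q r + - (q₁ * r i₄ + - (r₁ * q i₄))) + r₂ * q₃ ≈⟨ +-congʳ (+-cong (isotropic isL q∈L r∈L)
                                                            (-‿cong (+-cong (*-congˡ (perp r∈L)) (-‿cong (*-congˡ (perp q∈L)))))) ⟩
      (0# + - (q₁ * 0# + - (r₁ * 0#))) + r₂ * q₃        ≈⟨ solve 4 (λ q₁ r₁ r₂ q₃ →
                                                            (con (+ 0) :- (q₁ :* con (+ 0) :- r₁ :* con (+ 0))) :+ r₂ :* q₃ := r₂ :* q₃)
                                                          refl q₁ r₁ r₂ q₃ ⟩
      r₂ * q₃                                          ∎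
      where
      q₁ q₂ q₃ r₁ r₂ r₃ : Carrier
      q₁ = q i₁ ; q₂ = q i₂ ; q₃ = q i₃ ; r₁ = r i₁ ; r₂ = r i₂ ; r₃ = r i₃

    throughFlat : ∀ {r d} → OnLine r L → r i₃ * d ≈ 1# → SameLine L (otherLine (r i₂ * d))
    throughFlat {r} {d} r∈L r₃d≈1 = sameLine-spans (onOther (onLine-u L)) (onOther (onLine-w L)) x∈L flat∈L
      where
      flat∈L : OnLine (flat (r i₂ * d) 1#) L
      flat∈L = onLine-resp (flat-cong refl r₃d≈1) (projectPoint d x∈L r∈L (perp r∈L))
      onOther : ∀ {q} → OnLine q L → OnLine q (otherLine (r i₂ * d))
      onOther {q} q∈L = q i₁ , q i₃ , every4
        ( solve 2 (λ q₁ q₃ → q₁ := q₁ :* con (+ 1) :+ q₃ :* con (+ 0)) refl (q i₁) (q i₃)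
        , second
        , solve 2 (λ q₁ q₃ → q₃ := q₁ :* con (+ 0) :+ q₃ :* con (+ 1)) refl (q i₁) (q i₃)
        , trans (perp q∈L) (sym (lc-vanish (q i₁) (q i₃) refl refl)) )
        where
        second : q i₂ ≈ q i₁ * 0# + q i₃ * (r i₂ * d)
        second = begin
          q i₂                       ≈⟨ *-identityʳ (q i₂) ⟨
          q i₂ * 1#                  ≈⟨ *-congˡ r₃d≈1 ⟨
          q i₂ * (r i₃ * d)          ≈⟨ *-assoc (q i₂) (r i₃) d ⟨
          (q i₂ * r i₃) * d          ≈⟨ *-congʳ (cross q∈L r∈L) ⟩
          (r i₂ * q i₃) * d          ≈⟨ solve 4 (λ q₁ q₃ r₂ d → (r₂ :* q₃) :* d := q₁ :* con (+ 0) :+ q₃ :* (r₂ :* d))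
                                          refl (q i₁) (q i₃) (r i₂) d ⟩
          q i₁ * 0# + q i₃ * (r i₂ * d) ∎

    flatIsL₀ : (∀ q → OnLine q L → q i₃ ≈ 0#) → ∀ {q d} → OnLine q L → q i₂ * d ≈ 1# → SameLine L L₀
    flatIsL₀ third {q} {d} q∈L q₂d≈1 = sameLine-spans
      (onL₀ (third _ (onLine-u L)) (perp (onLine-u L))) (onL₀ (third _ (onLine-w L)) (perp (onLine-w L)))
      x∈L (onLine-resp (flat-cong q₂d≈1 (trans (*-congʳ (third q q∈L)) (zeroˡ d))) (projectPoint d x∈L q∈L (perp q∈L)))

    -- the second and third coordinates cannot both vanish on L: its spanning
    -- vectors would be dependent multiples of x
    notInX : (∀ q → OnLine q L → q i₂ ≈ 0#) → (∀ q → OnLine q L → q i₃ ≈ 0#) → ⊥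
    notInX second third = 1≉0 (proj₁ (independent 1# 0# λ i → trans (+-cong (*-congˡ (u≈0 i)) (zeroˡ _))
                                                                   (trans (+-identityʳ _) (zeroʳ 1#))))
      where
      independent : LinIndep (u L) (w L)
      independent = proj₁ isL
      onU : OnLine (u L) L
      onU = onLine-u L
      onW : OnLine (w L) L
      onW = onLine-w L
      u₁≈0 : u L i₁ ≈ 0#
      u₁≈0 = proj₂ (independent (- (w L i₁)) (u L i₁) (every4
        ( solve 2 (λ u₁ w₁ → :- w₁ :* u₁ :+ u₁ :* w₁ := con (+ 0)) refl (u L i₁) (w L i₁)
        , lc-vanish _ _ (second _ onU) (second _ onW)
        , lc-vanish _ _ (third _ onU) (third _ onW)
        , lc-vanish _ _ (perp onU) (perp onW) )))
      u≈0 : u L ≈ᵥ 0ᵥ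
      u≈0 = every4 (u₁≈0 , second _ onU , third _ onU , perp onU)

  classify : ∀ {L} → OtherLineThroughX L → ∃[ s ] SameLine L (otherLine s)
  classify {L} (isL , x∈L , L≉L₀) with someCoordinate L i₃
  ... | inj₂ (r , r∈L , r₃≉0) with proj₂ isField (r i₃) r₃≉0
  ...   | d , r₃d≈1 = r i₂ * d , throughFlat isL x∈L r∈L r₃d≈1
  classify {L} (isL , x∈L , L≉L₀) | inj₁ third with someCoordinate L i₂
  ... | inj₂ (q , q∈L , q₂≉0) with proj₂ isField (q i₂) q₂≉0
  ...   | d , q₂d≈1 = ⊥-elim (L≉L₀ (flatIsL₀ isL x∈L third q∈L q₂d≈1))
  classify {L} (isL , x∈L , L≉L₀) | inj₁ third | inj₁ second = ⊥-elim (notInX isL x∈L second third)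

module Coordinates {c ℓ : Level} (F : CommutativeRing c ℓ) (p f : ℕ) (α : Fin f → CommutativeRing.Carrier F) where
  open CommutativeRing F hiding (zero)
  open Over F
  open NormalForm F
  open IntegerSolver F

  sumFin-cong : ∀ n {g h : Fin n → Carrier} → (∀ i → g i ≈ h i) → sumFin n g ≈ sumFin n h
  sumFin-cong zero    e = refl
  sumFin-cong (suc n) e = +-cong (e zero) (sumFin-cong n (λ i → e (suc i)))

  coord-cong : ∀ {cs ds} → (∀ i → cs i ≡ ds i) → coord p f α cs ≈ coord p f α ds
  coord-cong same = sumFin-cong f (λ i → reflexive (≡.cong (λ m → natMul (Data.Fin.toℕ m) (α i)) (same i)))

  funToFin-cong : ∀ {m n} {g h : Fin m → Fin n} → (∀ x → g x ≡ h x) → Data.Fin.funToFin g ≡ Data.Fin.funToFin h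
  funToFin-cong {zero}  _ = ≡.refl
  funToFin-cong {suc m} e = ≡.cong₂ Data.Fin.combine (e zero) (funToFin-cong (λ x → e (suc x)))

  -- a basis gives decidable equality: compare coordinates
  decEq : IsBasisOverPrime p f α → Decidable _≈_
  decEq basis x y with proj₁ basis x | proj₁ basis y
  ... | cx , cx≈x | cy , cy≈y with FinP.all? (λ i → cx i FinP.≟ cy i)
  ... | yes same  = yes (trans (sym cx≈x) (trans (coord-cong same) cy≈y))
  ... | no differ = no (λ x≈y → differ (proj₂ basis cx cy (trans cx≈x (trans x≈y (sym cy≈y)))))

  Reached : Carrier → Set (c ⊔ ℓ)
  Reached k = ∃[ a ] ∃[ b ] InP α (M a b k)

  -- multiplying by t_{a,b,0} ∈ R adjusts a and b freely
  adjust : ∀ {k} → Reached k → ∀ a b → InP α (M a b k)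
  adjust {k} (a₀ , b₀ , inP) a b = resp (mul (genR (a − a₀) (b − b₀)) inP)
    (≈ₘ-trans (·ₘ-cong (t-as-M _ _) (≈ₘ-refl {x = M a₀ b₀ k}))
    (≈ₘ-trans (M-mul _ _ _ _ _ _) (M-cong
      (solve 4 (λ a a₀ b₀ k → (a :- a₀) :+ a₀ :+ (con (+ 0) :+ con (+ 0)) :* b₀ :+ con (+ 0) :* con (+ 0) :* k := a)
        refl a a₀ b₀ k)
      (solve 3 (λ b b₀ k → (b :- b₀) :+ b₀ :+ con (+ 0) :* k := b) refl b b₀ k)
      (+-identityˡ k))))

  reached-0 : Reached 0#
  reached-0 = 0# , 0# , resp one I-as-M

  reached-+ : ∀ {k k′} → Reached k → Reached k′ → Reached (k + k′)
  reached-+ (_ , _ , inP) (_ , _ , inP′) = _ , _ , resp (mul inP inP′) (M-mul _ _ _ _ _ _)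

  reached-resp : ∀ {k k′} → k ≈ k′ → Reached k → Reached k′
  reached-resp e (a , b , inP) = a , b , resp inP (M-cong refl refl e)

  reached-natMul : ∀ n {k} → Reached k → Reached (natMul n k)
  reached-natMul zero    _ = reached-0
  reached-natMul (suc n) r = reached-+ r (reached-natMul n r)

  reached-sum : ∀ n {g : Fin n → Carrier} → (∀ i → Reached (g i)) → Reached (sumFin n g)
  reached-sum zero    _ = reached-0
  reached-sum (suc n) r = reached-+ (r zero) (reached-sum n (λ i → r (suc i)))

  -- since θ_{αᵢ} = M 0 0 αᵢ ∈ P and the αᵢ span F, P contains every M a b k
  M-in-P : (∀ x → ∃[ cs ] (coord p f α cs ≈ x)) → ∀ a b k → InP α (M a b k)
  M-in-P spans a b k with spans k
  ... | cs , cs≈k = adjust (reached-resp cs≈k (reached-sum f (λ i →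
        reached-natMul (Data.Fin.toℕ (cs i)) (0# , 0# , resp (genθ i) (θ-as-M (α i)))))) a b

module Action {c ℓ : Level} (F : CommutativeRing c ℓ) (isField : Over.IsField F)
              (p f : ℕ) (α : Fin f → CommutativeRing.Carrier F) (basis : Over.IsBasisOverPrime F p f α) where
  open CommutativeRing F hiding (zero)
  open Over F
  open IntegerSolver F
  open NormalForm F
  open Quadrangle F
  open Coordinates F p f α
  open FieldGeometry F isField (decEq basis)

  inP : ∀ a b k → InP α (M a b k)
  inP = M-in-P (proj₁ basis)

  -- y₄ is invariant under P
  farPoints-preserved : ∀ g y → InP α g → FarPoint y → FarPoint (y ·ᵥ g)
  farPoints-preserved g y g∈P far =
    let _ , _ , _ , g≈ = normalForm g∈P
    in ⇒farPoint (λ y₄≈0 → farPoint⇒ far (trans (sym (act′ y g≈ i₄)) y₄≈0))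

  rescale : ∀ x {y e} → y * e ≈ 1# → (x * e) * y ≈ x
  rescale x {y} {e} ye≈1 = trans (solve 3 (λ x y e → (x :* e) :* y := x :* (y :* e)) refl x y e)
                                 (trans (*-congˡ ye≈1) (*-identityʳ x))

  rescale⁻¹ : ∀ {y₄ z₄ d e} t → y₄ * d ≈ 1# → z₄ * e ≈ 1# → (z₄ * d) * ((y₄ * e) * t) ≈ t
  rescale⁻¹ {y₄} {z₄} {d} {e} t y₄d≈1 z₄e≈1 =
    trans (solve 5 (λ z₄ d y₄ e t → (z₄ :* d) :* ((y₄ :* e) :* t) := ((y₄ :* d) :* (z₄ :* e)) :* t) refl z₄ d y₄ e t)
          (trans (*-congʳ (*-cong y₄d≈1 z₄e≈1)) (trans (*-congʳ (*-identityˡ 1#)) (*-identityˡ t)))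

  -- y is moved onto the representative (y₄ / z₄) z of ⟨ z ⟩
  farPoints-transitive : ∀ y z → FarPoint y → FarPoint z → ∃[ g ] (InP α g × SamePoint (y ·ᵥ g) z)
  farPoints-transitive y z farY farZ =
    let d , y₄d≈1 = proj₂ isField (y i₄) (farPoint⇒ farY)
        e , z₄e≈1 = proj₂ isField (z i₄) (farPoint⇒ farZ)
        a , b , k , moved = image-onto y ((y i₄ * e) ∙ᵥ z) y₄d≈1 (rescale (y i₄) z₄e≈1)
    in M a b k , inP a b k , z i₄ * d ,
       λ i → sym (trans (*-congˡ (≈ᵥ-trans (act y a b k) moved i)) (rescale⁻¹ (z i) y₄d≈1 z₄e≈1))

  stabiliser-trivial : ∀ g y → InP α g → FarPoint y → SamePoint (y ·ᵥ g) y → g ≈ₘ Iₘ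
  stabiliser-trivial g y g∈P far (s , y≈) =
    let _ , _ , _ , g≈ = normalForm g∈P
        a≈0 , b≈0 , k≈0 = fixesFarPoint (farPoint⇒ far) (λ i → trans (y≈ i) (*-congˡ (act′ y g≈ i)))
    in ≈ₘ-trans g≈ (≈ₘ-trans (M-cong a≈0 b≈0 k≈0) (≈ₘ-sym I-as-M))

  L₀-preserved : ∀ g → InP α g → SameLine (L₀ ^ₗ g) L₀
  L₀-preserved g g∈P = let _ , _ , _ , g≈ = normalForm g∈P in L₀-fixed g≈

  -- the q other lines through x, indexed through the coordinates in GF(p)^f
  otherLines : Σ (Fin (p ℕ.^ f) → Line) λ ℓs → ((∀ i → OtherLineThroughX (ℓs i)) ×
                 (∀ i j → SameLine (ℓs i) (ℓs j) → i ≡ j) ×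
                 (∀ L → OtherLineThroughX L → ∃[ i ] SameLine L (ℓs i)))
  otherLines = (λ i → otherLine (φ i)) , (λ i → otherLine-other (φ i)) , injective , surjective
    where
    digits : Fin (p ℕ.^ f) → (Fin f → Fin p)
    digits = Data.Fin.finToFun
    φ : Fin (p ℕ.^ f) → Carrier
    φ i = coord p f α (digits i)
    injective : ∀ i j → SameLine (otherLine (φ i)) (otherLine (φ j)) → i ≡ j
    injective i j same = begin
      i                              ≡⟨ FinP.funToFin-finToFin {f} {p} i ⟨
      Data.Fin.funToFin (digits i)   ≡⟨ funToFin-cong (proj₂ basis _ _ (otherLine-injective same)) ⟩
      Data.Fin.funToFin (digits j)   ≡⟨ FinP.funToFin-finToFin {f} {p} j ⟩
      j                              ∎
      where open ≡.≡-Reasoning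
    surjective : ∀ L → OtherLineThroughX L → ∃[ i ] SameLine L (otherLine (φ i))
    surjective L other =
      let s , L~s = classify other
          cs , cs≈s = proj₁ basis s
      in Data.Fin.funToFin cs ,
         sameLine-trans L~s (otherLine-cong (sym (trans (coord-cong (FinP.finToFun-funToFin cs)) cs≈s)))

  otherLines-preserved : ∀ g L → InP α g → OtherLineThroughX L → OtherLineThroughX (L ^ₗ g)
  otherLines-preserved g L g∈P other@(isL , x∈L , _) =
    let _ , _ , k , g≈ = normalForm g∈P
        s , L~s = classify other
        -- (0,s,1,0) ∈ L is mapped to a point with third coordinate 1, which is not on L₀
        third : (flat s 1# ·ᵥ g) i₃ ≈ 1#
        third = trans (act′ (flat s 1#) g≈ i₃) (trans (+-congˡ (zeroʳ k)) (+-identityʳ 1#))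
        notL₀ : ¬ SameLine (L ^ₗ g) L₀
        notL₀ same = 1≉0 (trans (sym third) (L₀-third (proj₁ (same _) (onLine-image g (proj₂ (L~s _) (onLine-w _))))))
    in isLine-image g≈ isL , onLine-resp (𝐱-fixed g≈) (onLine-image g x∈L) , notL₀

  otherLines-transitive : ∀ L L′ → OtherLineThroughX L → OtherLineThroughX L′ →
                          ∃[ g ] (InP α g × SameLine (L ^ₗ g) L′)
  otherLines-transitive L L′ other other′ =
    let s , L~s = classify other
        s′ , L′~s′ = classify other′
    in M 0# 0# (s′ − s) , inP _ _ _ ,
    sameLine-trans (sameLine-image (M 0# 0# (s′ − s)) L~s)
      (sameLine-trans (otherLine-shift s (≈ₘ-refl {x = M 0# 0# (s′ − s)}))
        (sameLine-trans (otherLine-cong (solve 2 (λ s s′ → s :+ (s′ :- s) := s′) refl s s′)) (sameLine-sym L′~s′)))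

  conclusion : Lemma3p12Conclusion p f α
  conclusion = farPoints-preserved , farPoints-transitive , stabiliser-trivial , L₀-preserved ,
               otherLines , otherLines-preserved , otherLines-transitive

-- The argument only uses that F is a field with a basis α over GF(p).
lemma3p12 : {c ℓ : Level} (F : CommutativeRing c ℓ) → Over.IsField F →
    (p f : ℕ) → Prime p → Over.HasChar F p →
    (α : Fin f → CommutativeRing.Carrier F) → Over.IsBasisOverPrime F p f α →
    Over.Lemma3p12Conclusion F p f α
lemma3p12 F isField p f _ _ α basis = Action.conclusion F isField p f α basis
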